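{- Let $G$ be a perfect graph with $n\ge1$ vertices, let $p,q\ge1$ be integers, and let $\omega=\max\{\omega(G),p,q\}$. Write $I(G\circ(K_p\cup K_q);x)=\sum_{k}s_kx^k$, and let $c=\left\lceil\frac{2n\omega-1}{\omega+1}\right\rceil$ and $t=2n-c$. Then \[ s_c\ge s_{c+1}\ge\cdots\ge s_{2n-1}\ge s_{2n}\quad\text{and}\quad s_0\le s_1\le\cdots\le s_{t-1}\le s_t . \]
   Context: All graphs are finite and simple. $\omega(G)$ is the clique number of $G$. A graph $G$ is perfect if $\chi(F)=\omega(F)$ for every induced subgraph $F$ of $G$, where $\chi$ is the chromatic number. $K_p\cup K_q$ is the disjoint union of the complete graphs $K_p$ and $K_q$. An independent set is a set of pairwise non-adjacent vertices; if $s_k$ is the number of independent sets of size $k$ in a graph $F$, the independence polynomial is $I(F;x)=\sum_{k\ge0}s_kx^k$. The corona $G\circ H$ is the graph obtained from $G$ and $|V(G)|$ disjoint copies of $H$, one for each vertex of $G$, by joining each vertex of $G$ to all vertices of its copy of $H$. -}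

module Defs where

open import Data.Bool using (Bool; true; false; _∧_; _∨_; not; if_then_else_)
open import Data.Nat using (ℕ; zero; suc; _+_; _*_; _∸_; _≤_; _/_)
open import Data.Fin using (Fin; zero; suc; remQuot; splitAt; _≟_)
open import Data.Fin.Subset using (Subset; _∈_; ∣_∣)
open import Data.Vec using (Vec; []; _∷_; lookup)
open import Data.List using (List; []; _∷_; map; _++_)
open import Data.Nat.ListAction using (sum)
open import Data.Product using (_×_; _,_; ∃)
open import Data.Sum using (inj₁; inj₂)
open import Relation.Nullary using (¬_)
open import Relation.Nullary.Decidable using (⌊_⌋)
open import Relation.Binary.PropositionalEquality using (_≡_; _≢_)
open import Function.Definitions using (Injective)

Graph : ℕ → Set
Graph n = Fin n → Fin n → Bool

Edge : ∀ {n} → Graph n → Fin n → Fin n → Set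
Edge G u v = G u v ≡ true

IsSimple : ∀ {n} → Graph n → Set
IsSimple G = (∀ u v → G u v ≡ G v u) × (∀ u → G u u ≡ false)

induced : ∀ {m n} → Graph n → (Fin m → Fin n) → Graph m
induced G f u v = G (f u) (f v)

IsClique : ∀ {n} → Graph n → Subset n → Set
IsClique G S = ∀ u v → u ∈ S → v ∈ S → u ≢ v → Edge G u v

HasCliqueNumber : ∀ {n} → Graph n → ℕ → Set
HasCliqueNumber {n} G k =
  (∃ λ (S : Subset n) → IsClique G S × ∣ S ∣ ≡ k)
  × (∀ (S : Subset n) → IsClique G S → ∣ S ∣ ≤ k)

Colorable : ∀ {n} → Graph n → ℕ → Set
Colorable {n} G k = ∃ λ (c : Fin n → Fin k) → ∀ u v → Edge G u v → c u ≢ c v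

HasChromaticNumber : ∀ {n} → Graph n → ℕ → Set
HasChromaticNumber G k = Colorable G k × (∀ j → Colorable G j → k ≤ j)

Perfect : ∀ {n} → Graph n → Set
Perfect {n} G =
  ∀ m (f : Fin m → Fin n) → Injective _≡_ _≡_ f →
  ∃ λ k → HasCliqueNumber (induced G f) k × HasChromaticNumber (induced G f) k

-- Vertex (i , a) with i : Fin n, a : Fin (1 + p + q):
-- a = 0 is the vertex i of G; a = 1+j with j < p is the j-th vertex of the
-- copy of K_p attached to i; a = 1+p+j (j < q) is the j-th vertex of the copy of K_q.
data Kind (p q : ℕ) : Set where
  root : Kind p q
  inP  : Fin p → Kind p q
  inQ  : Fin q → Kind p q

kind : ∀ {p q} → Fin (suc (p + q)) → Kind p q
kind zero = root
kind {p} (suc a) with splitAt p a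
... | inj₁ j = inP j
... | inj₂ j = inQ j

_==_ : ∀ {n} → Fin n → Fin n → Bool
u == v = ⌊ u ≟ v ⌋

kindAdj : ∀ {n p q} → Graph n → Fin n → Fin n → Kind p q → Kind p q → Bool
kindAdj G i j root    root    = G i j
kindAdj G i j root    (inP _) = i == j
kindAdj G i j root    (inQ _) = i == j
kindAdj G i j (inP _) root    = i == j
kindAdj G i j (inQ _) root    = i == j
kindAdj G i j (inP a) (inP b) = (i == j) ∧ not (a == b)
kindAdj G i j (inQ a) (inQ b) = (i == j) ∧ not (a == b)
kindAdj G i j (inP _) (inQ _) = false
kindAdj G i j (inQ _) (inP _) = false

corona : ∀ {n} → Graph n → (p q : ℕ) → Graph (n * suc (p + q))
corona {n} G p q u v with remQuot {n} (suc (p + q)) u | remQuot {n} (suc (p + q)) v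
... | (i , a) | (j , b) = kindAdj G i j (kind {p} {q} a) (kind {p} {q} b)

subsets : ∀ n → List (Subset n)
subsets zero = [] ∷ []
subsets (suc n) = map (true ∷_) (subsets n) ++ map (false ∷_) (subsets n)

allFinL : ∀ n → List (Fin n)
allFinL zero = []
allFinL (suc n) = zero ∷ map suc (allFinL n)

allL : ∀ {A : Set} → (A → Bool) → List A → Bool
allL P [] = true
allL P (x ∷ xs) = P x ∧ allL P xs

independentᵇ : ∀ {n} → Graph n → Subset n → Bool
independentᵇ {n} G S =
  allL (λ u → allL (λ v →
    not (lookup S u ∧ lookup S v ∧ not (u == v) ∧ G u v)) (allFinL n)) (allFinL n)

toℕ : Bool → ℕ
toℕ true = 1
toℕ false = 0

indepCount : ∀ {n} → Graph n → ℕ → ℕ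
indepCount {n} G k =
  sum (map (λ S → toℕ (independentᵇ G S ∧ (∣ S ∣ ==ℕ k))) (subsets n))
  where
    _==ℕ_ : ℕ → ℕ → Bool
    a ==ℕ b = ⌊ a Data.Nat.≟ b ⌋

ceilDiv : ℕ → (b : ℕ) → ℕ
ceilDiv a zero = 0
ceilDiv a (suc b) = (a + b) / suc b

-- An independent set of G ∘ (K_p ∪ K_q) consists of an independent set R of G (the vertices it
-- takes from G) and, in each copy of K_p ∪ K_q attached to a vertex outside R, at most one vertex
-- of K_p and at most one of K_q. Hence I(G ∘ (K_p ∪ K_q); x) = Σ_R x^|R| ((1 + p x)(1 + q x))^(n − |R|),
-- and it suffices that every summand has the claimed monotonicity. The coefficients e_i of a
-- product of d factors 1 + r x satisfy (i + 1) e_(i+1) ≤ ω (d − i) e_i when every r ≤ ω, and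
-- (d − i) e_i ≤ (i + 1) e_(i+1) when every r ≥ 1. With d = 2 (n − |R|) the first gives
-- e_(i+1) ≤ e_i from index c on, the second e_i ≤ e_(i+1) below index n, and t ≤ n.
module Submission where

open import Defs
open import Data.Bool using (Bool; true; false; _∧_; not)
open import Data.Bool.Properties using (∧-identityʳ; ∧-conicalˡ; ∧-conicalʳ; not-involutive; ¬-not; ⇔→≡)
open import Data.Empty using (⊥; ⊥-elim)
open import Data.Fin as Fin using (Fin; zero; suc; _≟_; combine; _↑ˡ_; _↑ʳ_)
import Data.Fin.Properties as Finₚ
open import Data.Fin.Subset using (Subset; ∣_∣; ∁)
open import Data.Fin.Subset.Properties using (∣∁p∣≡n∸∣p∣; ∣p∣≤n)
open import Data.List as List using (List; []; _∷_; map; length)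
open import Data.List.Properties using (map-++; map-∘)
open import Data.List.Relation.Unary.All using (All; []; _∷_)
open import Data.Nat
  using (ℕ; zero; suc; _+_; _*_; _∸_; _≤_; _<_; _⊔_; _%_; _≤?_; _<?_; z≤n; s≤s; s≤s⁻¹; >-nonZero)
import Data.Nat as ℕ using (_≟_)
open import Data.Nat.DivMod using (m≡m%n+[m/n]*n; m%n<n)
open import Data.Nat.ListAction using (sum)
open import Data.Nat.ListAction.Properties using (sum-++)
open import Data.Nat.Properties hiding (_≟_)
open import Data.Nat.Tactic.RingSolver using (solve-∀)
open import Algebra.Properties.CommutativeSemigroup +-commutativeSemigroup using (interchange; x∙yz≈y∙xz)
open import Data.Product using (_×_; _,_; proj₁; proj₂; uncurry)
open import Data.Sum using (inj₁; inj₂)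
open import Data.Vec using (Vec; []; _∷_; _++_; lookup; take; drop; tabulate)
open import Data.Vec.Properties using (take++drop≡id; lookup-++ˡ; lookup-++ʳ; lookup∘tabulate)
open import Function using (_∘_)
open import Function.Bundles using (mk⇔)
open import Relation.Binary.PropositionalEquality
open import Relation.Nullary using (yes; no; does; contradiction)
open import Relation.Nullary.Decidable using (⌊_⌋; dec-true; dec-false; isYes≗does; decidable-stable)

-- Sums over all subsets

sumSubsets : ∀ N → (Subset N → ℕ) → ℕ
sumSubsets zero    f = f []
sumSubsets (suc N) f = sumSubsets N (f ∘ (true ∷_)) + sumSubsets N (f ∘ (false ∷_))

sum-map-subsets : ∀ N (f : Subset N → ℕ) → sum (map f (subsets N)) ≡ sumSubsets N f
sum-map-subsets zero    f = +-identityʳ (f [])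
sum-map-subsets (suc N) f = begin
  sum (map f (map (true ∷_) (subsets N) List.++ map (false ∷_) (subsets N)))
    ≡⟨ cong sum (map-++ f (map (true ∷_) (subsets N)) _) ⟩
  sum (map f (map (true ∷_) (subsets N)) List.++ map f (map (false ∷_) (subsets N)))
    ≡⟨ sum-++ (map f (map (true ∷_) (subsets N))) _ ⟩
  sum (map f (map (true ∷_) (subsets N))) + sum (map f (map (false ∷_) (subsets N)))
    ≡⟨ sym (cong₂ _+_ (cong sum (map-∘ (subsets N))) (cong sum (map-∘ (subsets N)))) ⟩
  sum (map (f ∘ (true ∷_)) (subsets N)) + sum (map (f ∘ (false ∷_)) (subsets N))
    ≡⟨ cong₂ _+_ (sum-map-subsets N _) (sum-map-subsets N _) ⟩
  sumSubsets (suc N) f ∎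
  where open ≡-Reasoning

sumSubsets-cong : ∀ N {f g : Subset N → ℕ} → (∀ S → f S ≡ g S) → sumSubsets N f ≡ sumSubsets N g
sumSubsets-cong zero    f≗g = f≗g []
sumSubsets-cong (suc N) f≗g = cong₂ _+_ (sumSubsets-cong N (f≗g ∘ (true ∷_))) (sumSubsets-cong N (f≗g ∘ (false ∷_)))

sumSubsets-mono : ∀ N {f g : Subset N → ℕ} → (∀ S → f S ≤ g S) → sumSubsets N f ≤ sumSubsets N g
sumSubsets-mono zero    f≤g = f≤g []
sumSubsets-mono (suc N) f≤g = +-mono-≤ (sumSubsets-mono N (f≤g ∘ (true ∷_))) (sumSubsets-mono N (f≤g ∘ (false ∷_)))

sumSubsets-+ : ∀ N (f g : Subset N → ℕ) → sumSubsets N (λ S → f S + g S) ≡ sumSubsets N f + sumSubsets N g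
sumSubsets-+ zero    f g = refl
sumSubsets-+ (suc N) f g =
  trans (cong₂ _+_ (sumSubsets-+ N (f ∘ (true ∷_)) (g ∘ (true ∷_))) (sumSubsets-+ N (f ∘ (false ∷_)) (g ∘ (false ∷_))))
        (interchange (sumSubsets N (f ∘ (true ∷_))) _ _ _)

sumSubsets-*ˡ : ∀ N c (f : Subset N → ℕ) → sumSubsets N (λ S → c * f S) ≡ c * sumSubsets N f
sumSubsets-*ˡ zero    c f = refl
sumSubsets-*ˡ (suc N) c f =
  trans (cong₂ _+_ (sumSubsets-*ˡ N c _) (sumSubsets-*ˡ N c _)) (sym (*-distribˡ-+ c _ _))

sumSubsets-++ : ∀ a b (f : Subset (a + b) → ℕ) →
  sumSubsets (a + b) f ≡ sumSubsets a (λ x → sumSubsets b (λ y → f (x ++ y)))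
sumSubsets-++ zero    b f = refl
sumSubsets-++ (suc a) b f = cong₂ _+_ (sumSubsets-++ a b _) (sumSubsets-++ a b _)

sumSubsets-0 : ∀ N → sumSubsets N (λ _ → 0) ≡ 0
sumSubsets-0 zero    = refl
sumSubsets-0 (suc N) = cong₂ _+_ (sumSubsets-0 N) (sumSubsets-0 N)

atMostOneOf : ℕ → (ℕ → ℕ) → ℕ → ℕ
atMostOneOf r f c = f c + r * f (suc c)

sumSubsets-atMostOneOf : ∀ N r (w : Subset N → ℕ) (f : Subset N → ℕ → ℕ) c →
  sumSubsets N (λ R → w R * atMostOneOf r (f R) c) ≡ atMostOneOf r (λ d → sumSubsets N (λ R → w R * f R d)) c
sumSubsets-atMostOneOf N r w f c = begin
  sumSubsets N (λ R → w R * atMostOneOf r (f R) c)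
    ≡⟨ sumSubsets-cong N (λ R → distrib (w R) (f R c) r (f R (suc c))) ⟩
  sumSubsets N (λ R → w R * f R c + r * (w R * f R (suc c)))
    ≡⟨ sumSubsets-+ N _ _ ⟩
  sumSubsets N (λ R → w R * f R c) + sumSubsets N (λ R → r * (w R * f R (suc c)))
    ≡⟨ cong (sumSubsets N (λ R → w R * f R c) +_) (sumSubsets-*ˡ N r _) ⟩
  atMostOneOf r (λ d → sumSubsets N (λ R → w R * f R d)) c ∎
  where
  open ≡-Reasoning
  distrib : ∀ w x r y → w * (x + r * y) ≡ w * x + r * (w * y)
  distrib = solve-∀

emptyᵇ : ∀ {N} → Subset N → Bool
emptyᵇ []          = true
emptyᵇ (true ∷ _)  = false
emptyᵇ (false ∷ S) = emptyᵇ S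

atMostOneᵇ : ∀ {N} → Subset N → Bool
atMostOneᵇ []          = true
atMostOneᵇ (true ∷ S)  = emptyᵇ S
atMostOneᵇ (false ∷ S) = atMostOneᵇ S

sumSubsets-emptyᵇ : ∀ N (f : ℕ → ℕ) → sumSubsets N (λ P → toℕ (emptyᵇ P) * f ∣ P ∣) ≡ f 0
sumSubsets-emptyᵇ zero    f = +-identityʳ (f 0)
sumSubsets-emptyᵇ (suc N) f = cong₂ _+_ (sumSubsets-0 N) (sumSubsets-emptyᵇ N f)

sumSubsets-atMostOneᵇ : ∀ N (f : ℕ → ℕ) →
  sumSubsets N (λ P → toℕ (atMostOneᵇ P) * f ∣ P ∣) ≡ atMostOneOf N f 0
sumSubsets-atMostOneᵇ zero    f = refl
sumSubsets-atMostOneᵇ (suc N) f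
  rewrite sumSubsets-emptyᵇ N (f ∘ suc) | sumSubsets-atMostOneᵇ N f = x∙yz≈y∙xz (f 1) (f 0) (N * f 1)

-- Coefficients of products of linear factors

-- A polynomial is its coefficient sequence: δ a is x^a, shift j f is x^j f and
-- mulLinear r f is (1 + r x) f.
δ : ℕ → ℕ → ℕ
δ zero    zero    = 1
δ zero    (suc k) = 0
δ (suc a) zero    = 0
δ (suc a) (suc k) = δ a k

shift : ℕ → (ℕ → ℕ) → ℕ → ℕ
shift zero    f k       = f k
shift (suc j) f zero    = 0
shift (suc j) f (suc k) = shift j f k

mulLinear : ℕ → (ℕ → ℕ) → ℕ → ℕ
mulLinear r f k = f k + r * shift 1 f k

linearProduct : List ℕ → ℕ → ℕ
linearProduct []       = δ 0
linearProduct (r ∷ rs) = mulLinear r (linearProduct rs)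

linearProduct-vanishes : ∀ rs k → length rs < k → linearProduct rs k ≡ 0
linearProduct-vanishes []       (suc k) _ = refl
linearProduct-vanishes (r ∷ rs) (suc k) (s≤s lt)
  rewrite linearProduct-vanishes rs (suc k) (m<n⇒m<1+n lt) | linearProduct-vanishes rs k lt = *-zeroʳ r

-- x₁, x₀, y are the coefficients f (i + 1), f i, f (i − 1) of f (with f (−1) = 0); the conclusion
-- is the bound for (1 + r x) f, which has one more factor than f.
ratio-step-≤ : ∀ {w r d i x₁ x₀ y} → r ≤ w →
  suc i * x₁ ≤ w * d * x₀ → i * x₀ ≤ w * suc d * y →
  suc i * (x₁ + r * x₀) ≤ w * suc d * (x₀ + r * y)
ratio-step-≤ {w} {r} {d} {i} {x₁} {x₀} {y} r≤w hi lo = begin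
  suc i * (x₁ + r * x₀)                ≡⟨ expandˡ i x₁ r x₀ ⟩
  suc i * x₁ + (r * x₀ + r * (i * x₀)) ≤⟨ +-mono-≤ hi (+-mono-≤ (*-monoˡ-≤ x₀ r≤w) (*-monoʳ-≤ r lo)) ⟩
  w * d * x₀ + (w * x₀ + r * (w * suc d * y)) ≡⟨ expandʳ w d x₀ r y ⟩
  w * suc d * (x₀ + r * y)             ∎
  where
  open ≤-Reasoning
  expandˡ : ∀ i x₁ r x₀ → suc i * (x₁ + r * x₀) ≡ suc i * x₁ + (r * x₀ + r * (i * x₀))
  expandˡ = solve-∀
  expandʳ : ∀ w d x₀ r y → w * d * x₀ + (w * x₀ + r * (w * suc d * y)) ≡ w * suc d * (x₀ + r * y)
  expandʳ = solve-∀

ratio-step-≥ : ∀ {r d i x₁ x₀ y} → 1 ≤ r →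
  d * x₀ ≤ suc i * x₁ → suc d * y ≤ i * x₀ →
  suc d * (x₀ + r * y) ≤ suc i * (x₁ + r * x₀)
ratio-step-≥ {r} {d} {i} {x₁} {x₀} {y} 1≤r hi lo = begin
  suc d * (x₀ + r * y)               ≡⟨ expandˡ d x₀ r y ⟩
  d * x₀ + (x₀ + r * (suc d * y))    ≤⟨ +-mono-≤ hi (+-mono-≤ (m≤n*m x₀ r ⦃ >-nonZero 1≤r ⦄) (*-monoʳ-≤ r lo)) ⟩
  suc i * x₁ + (r * x₀ + r * (i * x₀)) ≡⟨ expandʳ i x₁ r x₀ ⟩
  suc i * (x₁ + r * x₀)              ∎
  where
  open ≤-Reasoning
  expandˡ : ∀ d x₀ r y → suc d * (x₀ + r * y) ≡ d * x₀ + (x₀ + r * (suc d * y))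
  expandˡ = solve-∀
  expandʳ : ∀ i x₁ r x₀ → suc i * x₁ + (r * x₀ + r * (i * x₀)) ≡ suc i * (x₁ + r * x₀)
  expandʳ = solve-∀

linearProduct-ratio-≤ : ∀ {w} rs → All (_≤ w) rs → ∀ i d → i + d ≡ length rs →
  suc i * linearProduct rs (suc i) ≤ w * d * linearProduct rs i
linearProduct-ratio-≤ {w} rs _ i zero eq = begin
  suc i * linearProduct rs (suc i) ≡⟨ cong (suc i *_) (linearProduct-vanishes rs (suc i) (s≤s len≤i)) ⟩
  suc i * 0                        ≡⟨ *-zeroʳ (suc i) ⟩
  0                                ≤⟨ z≤n ⟩
  w * 0 * linearProduct rs i       ∎
  where
  open ≤-Reasoning
  len≤i : length rs ≤ i
  len≤i = ≤-reflexive (trans (sym eq) (+-identityʳ i))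
linearProduct-ratio-≤ [] [] zero    (suc d) ()
linearProduct-ratio-≤ [] [] (suc i) (suc d) ()
linearProduct-ratio-≤ {w} (r ∷ rs) (r≤w ∷ rs≤w) i (suc d) eq =
  ratio-step-≤ {i = i} r≤w (linearProduct-ratio-≤ rs rs≤w i d (suc-injective (trans (sym (+-suc i d)) eq))) (shifted i eq)
  where
  shifted : ∀ i → i + suc d ≡ suc (length rs) → i * linearProduct rs i ≤ w * suc d * shift 1 (linearProduct rs) i
  shifted zero    _ = z≤n
  shifted (suc j) e = linearProduct-ratio-≤ rs rs≤w j (suc d) (suc-injective e)

linearProduct-ratio-≥ : ∀ rs → All (1 ≤_) rs → ∀ i d → i + d ≡ length rs →
  d * linearProduct rs i ≤ suc i * linearProduct rs (suc i)
linearProduct-ratio-≥ rs _ i zero eq = z≤n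
linearProduct-ratio-≥ [] [] zero    (suc d) ()
linearProduct-ratio-≥ [] [] (suc i) (suc d) ()
linearProduct-ratio-≥ (r ∷ rs) (1≤r ∷ rs≥1) i (suc d) eq =
  ratio-step-≥ {d = d} {i = i} 1≤r (linearProduct-ratio-≥ rs rs≥1 i d (suc-injective (trans (sym (+-suc i d)) eq))) (shifted i eq)
  where
  shifted : ∀ i → i + suc d ≡ suc (length rs) → suc d * shift 1 (linearProduct rs) i ≤ i * linearProduct rs i
  shifted zero    _ = ≤-reflexive (*-zeroʳ (suc d))
  shifted (suc j) e = linearProduct-ratio-≥ rs rs≥1 j (suc d) (suc-injective e)

linearProduct-antitone : ∀ {w} rs → All (_≤ w) rs → ∀ i → w * (length rs ∸ i) ≤ suc i →
  linearProduct rs (suc i) ≤ linearProduct rs i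
linearProduct-antitone {w} rs rs≤w i wd≤1+i with suc i ≤? length rs
... | no  i≥len = ≤-trans (≤-reflexive (linearProduct-vanishes rs (suc i) (≰⇒> i≥len))) z≤n
... | yes i<len = *-cancelˡ-≤ (suc i) (begin
  suc i * a (suc i)          ≤⟨ linearProduct-ratio-≤ rs rs≤w i d (m+[n∸m]≡n (<⇒≤ i<len)) ⟩
  w * d * a i                ≤⟨ *-monoˡ-≤ (a i) wd≤1+i ⟩
  suc i * a i                ∎)
  where
  open ≤-Reasoning
  a : ℕ → ℕ
  a = linearProduct rs
  d : ℕ
  d = length rs ∸ i

linearProduct-monotone : ∀ rs → All (1 ≤_) rs → ∀ i → suc i ≤ length rs ∸ i →
  linearProduct rs i ≤ linearProduct rs (suc i)
linearProduct-monotone rs rs≥1 i 1+i≤d = *-cancelˡ-≤ (suc i) (begin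
  suc i * a i                ≤⟨ *-monoˡ-≤ (a i) 1+i≤d ⟩
  d * a i                    ≤⟨ linearProduct-ratio-≥ rs rs≥1 i d (m+[n∸m]≡n i≤len) ⟩
  suc i * a (suc i)          ∎)
  where
  open ≤-Reasoning
  a : ℕ → ℕ
  a = linearProduct rs
  d : ℕ
  d = length rs ∸ i
  i≤len : i ≤ length rs
  i≤len = ≮⇒≥ λ len<i → contradiction (≤-trans 1+i≤d (≤-reflexive (m≤n⇒m∸n≡0 (<⇒≤ len<i)))) λ ()

shift-+ : ∀ j f i → shift j f (j + i) ≡ f i
shift-+ zero    f i = refl
shift-+ (suc j) f i = shift-+ j f i

shift-< : ∀ j f k → k < j → shift j f k ≡ 0
shift-< (suc j) f zero    _        = refl
shift-< (suc j) f (suc k) (s≤s lt) = shift-< j f k lt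

shift-δ : ∀ b k → shift b (δ 0) k ≡ δ b k
shift-δ zero    k       = refl
shift-δ (suc b) zero    = refl
shift-δ (suc b) (suc k) = shift-δ b k

shift-mulLinear : ∀ b r f k → shift b (mulLinear r f) k ≡ atMostOneOf r (λ c → shift c f k) b
shift-mulLinear zero    r f k       = refl
shift-mulLinear (suc b) r f zero    = sym (*-zeroʳ r)
shift-mulLinear (suc b) r f (suc k) = shift-mulLinear b r f k

-- I(K_p ∪ K_q; x) = (1 + p x)(1 + q x), so coronaTerm p q j m is x^j I(K_p ∪ K_q; x)^m.
pairFactors : ℕ → ℕ → ℕ → List ℕ
pairFactors p q zero    = []
pairFactors p q (suc m) = p ∷ q ∷ pairFactors p q m

length-pairFactors : ∀ p q m → length (pairFactors p q m) ≡ m + m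
length-pairFactors p q zero    = refl
length-pairFactors p q (suc m) = cong suc (trans (cong suc (length-pairFactors p q m)) (sym (+-suc m m)))

All-pairFactors : ∀ {P : ℕ → Set} {p q} → P p → P q → ∀ m → All P (pairFactors p q m)
All-pairFactors Pp Pq zero    = []
All-pairFactors Pp Pq (suc m) = Pp ∷ Pq ∷ All-pairFactors Pp Pq m

coronaTerm : ℕ → ℕ → ℕ → ℕ → ℕ → ℕ
coronaTerm p q j m = shift j (linearProduct (pairFactors p q m))

2Nw≤k[1+w]+1⇒N≤k : ∀ {w N k} → 1 ≤ w → 2 * N * w ≤ k * suc w + 1 → N ≤ k
2Nw≤k[1+w]+1⇒N≤k {w} {N} {k} 1≤w h = s≤s⁻¹ (*-cancelʳ-< (suc w) N (suc k) (begin-strict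
  N * suc w           ≡⟨ *-suc N w ⟩
  N + N * w           ≤⟨ +-monoˡ-≤ (N * w) (m≤m*n N w ⦃ >-nonZero 1≤w ⦄) ⟩
  N * w + N * w       ≡⟨ double N w ⟩
  2 * N * w           ≤⟨ h ⟩
  k * suc w + 1       <⟨ +-monoʳ-< (k * suc w) (s≤s 1≤w) ⟩
  k * suc w + suc w   ≡⟨ +-comm (k * suc w) (suc w) ⟩
  suc k * suc w       ∎))
  where
  open ≤-Reasoning
  double : ∀ N w → N * w + N * w ≡ 2 * N * w
  double = solve-∀

w[2m∸i]≤1+i : ∀ {w j m i} → 1 ≤ w → 2 * (j + m) * w ≤ (j + i) * suc w + 1 → w * (m + m ∸ i) ≤ suc i
w[2m∸i]≤1+i {w} {j} {m} {i} 1≤w h with i ≤? m + m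
... | no  i>2m rewrite m≤n⇒m∸n≡0 (<⇒≤ (≰⇒> i>2m)) | *-zeroʳ w = z≤n
... | yes i≤2m = +-cancelʳ-≤ ((j + j + i) * w) (w * d) (suc i) (begin
  w * d + (j + j + i) * w      ≡⟨ e₁ w d j i ⟩
  (j + j + (i + d)) * w        ≡⟨ cong (λ s → (j + j + s) * w) (m+[n∸m]≡n i≤2m) ⟩
  (j + j + (m + m)) * w        ≡⟨ e₂ j m w ⟩
  2 * (j + m) * w              ≤⟨ h ⟩
  (j + i) * suc w + 1          ≡⟨ e₃ j i w ⟩
  suc i + (j * w + i * w + j)  ≤⟨ +-monoʳ-≤ (suc i) (+-monoʳ-≤ (j * w + i * w) (m≤m*n j w ⦃ >-nonZero 1≤w ⦄)) ⟩
  suc i + (j * w + i * w + j * w) ≡⟨ e₄ j i w ⟩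
  suc i + (j + j + i) * w      ∎)
  where
  open ≤-Reasoning
  d : ℕ
  d = m + m ∸ i
  e₁ : ∀ w d j i → w * d + (j + j + i) * w ≡ (j + j + (i + d)) * w
  e₁ = solve-∀
  e₂ : ∀ j m w → (j + j + (m + m)) * w ≡ 2 * (j + m) * w
  e₂ = solve-∀
  e₃ : ∀ j i w → (j + i) * suc w + 1 ≡ suc i + (j * w + i * w + j)
  e₃ = solve-∀
  e₄ : ∀ j i w → suc i + (j * w + i * w + j * w) ≡ suc i + (j + j + i) * w
  e₄ = solve-∀

coronaTerm-antitone : ∀ {p q w} j m k → 1 ≤ w → p ≤ w → q ≤ w →
  2 * (j + m) * w ≤ k * suc w + 1 → coronaTerm p q j m (suc k) ≤ coronaTerm p q j m k
coronaTerm-antitone {p} {q} {w} j m k 1≤w p≤w q≤w h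
  with i , refl ← m≤n⇒∃[o]m+o≡n {n = k} (≤-trans (m≤m+n j m) (2Nw≤k[1+w]+1⇒N≤k 1≤w h))
  rewrite sym (+-suc j i) | shift-+ j (linearProduct (pairFactors p q m)) (suc i)
        | shift-+ j (linearProduct (pairFactors p q m)) i =
  linearProduct-antitone (pairFactors p q m) (All-pairFactors p≤w q≤w m) i
    (subst (λ l → w * (l ∸ i) ≤ suc i) (sym (length-pairFactors p q m)) (w[2m∸i]≤1+i {j = j} {m = m} 1≤w h))

coronaTerm-monotone : ∀ {p q} j m k → 1 ≤ p → 1 ≤ q → k < j + m →
  coronaTerm p q j m k ≤ coronaTerm p q j m (suc k)
coronaTerm-monotone {p} {q} j m k 1≤p 1≤q k<j+m with k <? j
... | yes k<j rewrite shift-< j (linearProduct (pairFactors p q m)) k k<j = z≤n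
... | no  k≮j
  with i , refl ← m≤n⇒∃[o]m+o≡n {n = k} (≮⇒≥ k≮j)
  rewrite sym (+-suc j i) | shift-+ j (linearProduct (pairFactors p q m)) (suc i)
        | shift-+ j (linearProduct (pairFactors p q m)) i =
  linearProduct-monotone (pairFactors p q m) (All-pairFactors 1≤p 1≤q m) i
    (subst (λ l → suc i ≤ l ∸ i) (sym (length-pairFactors p q m)) 1+i≤2m∸i)
  where
  i<m : i < m
  i<m = +-cancelˡ-≤ j (suc i) m k<j+m
  1+i≤2m∸i : suc i ≤ m + m ∸ i
  1+i≤2m∸i = subst (_≤ m + m ∸ i) (m+n∸n≡m (suc i) i) (∸-monoˡ-≤ i (+-mono-≤ i<m (<⇒≤ i<m)))

-- Boolean reflection

toℕ-∧ : ∀ a b → toℕ (a ∧ b) ≡ toℕ a * toℕ b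
toℕ-∧ true  b = sym (+-identityʳ (toℕ b))
toℕ-∧ false b = refl

toℕ-≟ : ∀ a k → toℕ ⌊ a ℕ.≟ k ⌋ ≡ δ a k
toℕ-≟ a k = trans (cong toℕ (isYes≗does (a ℕ.≟ k))) (toℕ-does a k)
  where
  toℕ-does : ∀ a k → toℕ (does (a ℕ.≟ k)) ≡ δ a k
  toℕ-does zero    zero    = refl
  toℕ-does zero    (suc k) = refl
  toℕ-does (suc a) zero    = refl
  toℕ-does (suc a) (suc k) = toℕ-does a k

allL-map : ∀ {A B : Set} (P : B → Bool) (f : A → B) xs → allL P (map f xs) ≡ allL (P ∘ f) xs
allL-map P f []       = refl
allL-map P f (x ∷ xs) = cong (P (f x) ∧_) (allL-map P f xs)

allL-allFinL⁻ : ∀ {n} (P : Fin n → Bool) → allL P (allFinL n) ≡ true → ∀ i → P i ≡ true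
allL-allFinL⁻ {suc n} P h zero    = ∧-conicalˡ _ _ h
allL-allFinL⁻ {suc n} P h (suc i) =
  allL-allFinL⁻ (P ∘ suc) (trans (sym (allL-map P suc (allFinL n))) (∧-conicalʳ _ _ h)) i

allL-allFinL⁺ : ∀ {n} (P : Fin n → Bool) → (∀ i → P i ≡ true) → allL P (allFinL n) ≡ true
allL-allFinL⁺ {zero}  P h = refl
allL-allFinL⁺ {suc n} P h =
  cong₂ _∧_ (h zero) (trans (allL-map P suc (allFinL n)) (allL-allFinL⁺ (P ∘ suc) (h ∘ suc)))

==-refl : ∀ {n} (i : Fin n) → (i == i) ≡ true
==-refl i = trans (isYes≗does (i ≟ i)) (dec-true (i ≟ i) refl)

==-≢ : ∀ {n} {i j : Fin n} → i ≢ j → (i == j) ≡ false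
==-≢ {i = i} {j} i≢j = trans (isYes≗does (i ≟ j)) (dec-false (i ≟ j) i≢j)

Independent : ∀ {N} → Graph N → Subset N → Set
Independent G S = ∀ u v → lookup S u ≡ true → lookup S v ≡ true → u ≢ v → G u v ≡ false

independentᵇ⁻ : ∀ {N} (G : Graph N) S → independentᵇ G S ≡ true → Independent G S
independentᵇ⁻ G S h u v Su Sv u≢v = pairCheck (allL-allFinL⁻ _ (allL-allFinL⁻ _ h u) v)
  where
  pairCheck : not (lookup S u ∧ lookup S v ∧ not (u == v) ∧ G u v) ≡ true → G u v ≡ false
  pairCheck e rewrite Su | Sv | ==-≢ u≢v = trans (sym (not-involutive (G u v))) (cong not e)

independentᵇ⁺ : ∀ {N} (G : Graph N) S → Independent G S → independentᵇ G S ≡ true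
independentᵇ⁺ G S ind = allL-allFinL⁺ _ (λ u → allL-allFinL⁺ _ (pairCheck u))
  where
  pairCheck : ∀ u v → not (lookup S u ∧ lookup S v ∧ not (u == v) ∧ G u v) ≡ true
  pairCheck u v with lookup S u in Su | lookup S v in Sv | u ≟ v
  ... | false | _     | _        = refl
  ... | true  | false | _        = refl
  ... | true  | true  | yes refl = refl
  ... | true  | true  | no  u≢v  rewrite ind u v Su Sv u≢v = refl

emptyᵇ⁻ : ∀ {N} (B : Subset N) → emptyᵇ B ≡ true → ∀ a → lookup B a ≡ false
emptyᵇ⁻ (false ∷ B) h zero    = refl
emptyᵇ⁻ (false ∷ B) h (suc a) = emptyᵇ⁻ B h a

emptyᵇ⁺ : ∀ {N} (B : Subset N) → (∀ a → lookup B a ≡ false) → emptyᵇ B ≡ true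
emptyᵇ⁺ []          h = refl
emptyᵇ⁺ (true ∷ B)  h = contradiction (h zero) λ ()
emptyᵇ⁺ (false ∷ B) h = emptyᵇ⁺ B (h ∘ suc)

atMostOneᵇ⁻ : ∀ {N} (B : Subset N) → atMostOneᵇ B ≡ true →
  ∀ a b → lookup B a ≡ true → lookup B b ≡ true → a ≡ b
atMostOneᵇ⁻ (true ∷ B)  h zero    zero    _  _  = refl
atMostOneᵇ⁻ (true ∷ B)  h zero    (suc b) _  Bb = contradiction (trans (sym Bb) (emptyᵇ⁻ B h b)) λ ()
atMostOneᵇ⁻ (true ∷ B)  h (suc a) _       Ba _  = contradiction (trans (sym Ba) (emptyᵇ⁻ B h a)) λ ()
atMostOneᵇ⁻ (false ∷ B) h (suc a) (suc b) Ba Bb = cong suc (atMostOneᵇ⁻ B h a b Ba Bb)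

atMostOneᵇ⁺ : ∀ {N} (B : Subset N) → (∀ a b → lookup B a ≡ true → lookup B b ≡ true → a ≡ b) →
  atMostOneᵇ B ≡ true
atMostOneᵇ⁺ []          h = refl
atMostOneᵇ⁺ (true ∷ B)  h = emptyᵇ⁺ B (λ a → ¬-not λ Ba → Finₚ.0≢1+n (h zero (suc a) refl Ba))
atMostOneᵇ⁺ (false ∷ B) h = atMostOneᵇ⁺ B (λ a b Ba Bb → Finₚ.suc-injective (h (suc a) (suc b) Ba Bb))

take-++ : ∀ {A : Set} {m n} (xs : Vec A m) (ys : Vec A n) → take m (xs ++ ys) ≡ xs
take-++ []       ys = refl
take-++ (x ∷ xs) ys = cong (x ∷_) (take-++ xs ys)

drop-++ : ∀ {A : Set} {m n} (xs : Vec A m) (ys : Vec A n) → drop m (xs ++ ys) ≡ ys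
drop-++ []       ys = refl
drop-++ (x ∷ xs) ys = drop-++ xs ys

lookup-↑ˡ : ∀ {A : Set} m {n} (xs : Vec A (m + n)) a → lookup xs (a ↑ˡ n) ≡ lookup (take m xs) a
lookup-↑ˡ m xs a =
  trans (cong (λ ys → lookup ys (a ↑ˡ _)) (sym (take++drop≡id m xs))) (lookup-++ˡ (take m xs) (drop m xs) a)

lookup-↑ʳ : ∀ {A : Set} m {n} (xs : Vec A (m + n)) a → lookup xs (m ↑ʳ a) ≡ lookup (drop m xs) a
lookup-↑ʳ m xs a =
  trans (cong (λ ys → lookup ys (m ↑ʳ a)) (sym (take++drop≡id m xs))) (lookup-++ʳ (take m xs) (drop m xs) a)

∣++∣ : ∀ {m n} (x : Subset m) (y : Subset n) → ∣ x ++ y ∣ ≡ ∣ x ∣ + ∣ y ∣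
∣++∣ []          y = refl
∣++∣ (true ∷ x)  y = cong suc (∣++∣ x y)
∣++∣ (false ∷ x) y = ∣++∣ x y

-- Independent sets of the corona

-- Vertex (i , a) of the corona is combine i a, so a vertex set S splits into blocks
-- block n S i ⊆ Fin (1 + p + q), one for each vertex i of G, whose position zero is i itself.
module _ (p q : ℕ) where

  blockOkᵇ : Subset (suc (p + q)) → Bool
  blockOkᵇ (true ∷ B)  = emptyᵇ B
  blockOkᵇ (false ∷ B) = atMostOneᵇ (take p B) ∧ atMostOneᵇ (drop p B)

  block : ∀ m → Subset (m * suc (p + q)) → Fin m → Subset (suc (p + q))
  block (suc m) S zero    = take (suc (p + q)) S
  block (suc m) S (suc i) = block m (drop (suc (p + q)) S) i

  roots : ∀ m → Subset (m * suc (p + q)) → Subset m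
  roots m S = tabulate (λ i → lookup (block m S i) zero)

  blocksOkᵇ : ∀ m → Subset (m * suc (p + q)) → Bool
  blocksOkᵇ m S = allL (λ i → blockOkᵇ (block m S i)) (allFinL m)

  lookup-combine : ∀ m (S : Subset (m * suc (p + q))) i a → lookup S (combine i a) ≡ lookup (block m S i) a
  lookup-combine (suc m) S zero    a = lookup-↑ˡ (suc (p + q)) S a
  lookup-combine (suc m) S (suc i) a =
    trans (lookup-↑ʳ (suc (p + q)) S (combine i a)) (lookup-combine m (drop (suc (p + q)) S) i a)

  roots-++ : ∀ m B (S : Subset (m * suc (p + q))) → roots (suc m) (B ++ S) ≡ lookup B zero ∷ roots m S
  roots-++ m B S rewrite take-++ B S | drop-++ B S = refl

  blocksOkᵇ-++ : ∀ m B (S : Subset (m * suc (p + q))) → blocksOkᵇ (suc m) (B ++ S) ≡ blockOkᵇ B ∧ blocksOkᵇ m S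
  blocksOkᵇ-++ m B S rewrite take-++ B S | allL-map (λ i → blockOkᵇ (block (suc m) (B ++ S) i)) suc (allFinL m)
    | drop-++ B S = refl

  kind-↑ˡ : ∀ x → kind {p} {q} (suc (x ↑ˡ q)) ≡ inP x
  kind-↑ˡ x rewrite Finₚ.splitAt-↑ˡ p x q = refl

  kind-↑ʳ : ∀ y → kind {p} {q} (suc (p ↑ʳ y)) ≡ inQ y
  kind-↑ʳ y rewrite Finₚ.splitAt-↑ʳ p q y = refl

  kind-suc≢root : ∀ a → kind {p} {q} (suc a) ≢ root
  kind-suc≢root a with Fin.splitAt p a
  ... | inj₁ _ = λ ()
  ... | inj₂ _ = λ ()

  coronaTerm-suc : ∀ c m k →
    coronaTerm p q c (suc m) k ≡ atMostOneOf p (atMostOneOf q (λ s → coronaTerm p q (s + c) m k)) 0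
  coronaTerm-suc c m k = trans (shift-mulLinear c p (mulLinear q L) k)
    (cong₂ (λ x y → x + p * y) (shift-mulLinear c q L k) (shift-mulLinear (suc c) q L k))
    where
    L : ℕ → ℕ
    L = linearProduct (pairFactors p q m)

  sumSubsets-blockOkᵇ : ∀ (g : Bool → ℕ → ℕ) →
    sumSubsets (suc (p + q)) (λ B → toℕ (blockOkᵇ B) * g (lookup B zero) ∣ B ∣)
      ≡ g true 1 + atMostOneOf p (atMostOneOf q (g false)) 0
  sumSubsets-blockOkᵇ g = cong₂ _+_ (sumSubsets-emptyᵇ (p + q) (g true ∘ suc)) (begin
    sumSubsets (p + q) (λ B → toℕ (atMostOneᵇ (take p B) ∧ atMostOneᵇ (drop p B)) * g false ∣ B ∣)
      ≡⟨ sumSubsets-++ p q _ ⟩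
    sumSubsets p (λ P → sumSubsets q (λ Q →
      toℕ (atMostOneᵇ (take p (P ++ Q)) ∧ atMostOneᵇ (drop p (P ++ Q))) * g false ∣ P ++ Q ∣))
      ≡⟨ sumSubsets-cong p (λ P → sumSubsets-cong q (split P)) ⟩
    sumSubsets p (λ P → sumSubsets q (λ Q → toℕ (atMostOneᵇ P) * (toℕ (atMostOneᵇ Q) * g false (∣ Q ∣ + ∣ P ∣))))
      ≡⟨ sumSubsets-cong p (λ P → trans (sumSubsets-*ˡ q (toℕ (atMostOneᵇ P)) _)
           (cong (toℕ (atMostOneᵇ P) *_) (sumSubsets-atMostOneᵇ q (λ s → g false (s + ∣ P ∣))))) ⟩
    sumSubsets p (λ P → toℕ (atMostOneᵇ P) * atMostOneOf q (g false) ∣ P ∣)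
      ≡⟨ sumSubsets-atMostOneᵇ p (atMostOneOf q (g false)) ⟩
    atMostOneOf p (atMostOneOf q (g false)) 0 ∎)
    where
    open ≡-Reasoning
    split : ∀ (P : Subset p) (Q : Subset q) →
      toℕ (atMostOneᵇ (take p (P ++ Q)) ∧ atMostOneᵇ (drop p (P ++ Q))) * g false ∣ P ++ Q ∣
        ≡ toℕ (atMostOneᵇ P) * (toℕ (atMostOneᵇ Q) * g false (∣ Q ∣ + ∣ P ∣))
    split P Q rewrite take-++ P Q | drop-++ P Q | ∣++∣ P Q | +-comm ∣ P ∣ ∣ Q ∣ =
      trans (cong (_* g false (∣ Q ∣ + ∣ P ∣)) (toℕ-∧ (atMostOneᵇ P) (atMostOneᵇ Q))) (*-assoc (toℕ (atMostOneᵇ P)) _ _)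

  weight-++ : ∀ m (φ : Subset (suc m) → Bool) B (S : Subset (m * suc (p + q))) →
    toℕ (φ (roots (suc m) (B ++ S)) ∧ blocksOkᵇ (suc m) (B ++ S))
      ≡ toℕ (blockOkᵇ B) * toℕ (φ (lookup B zero ∷ roots m S) ∧ blocksOkᵇ m S)
  weight-++ m φ B S rewrite roots-++ m B S | blocksOkᵇ-++ m B S = pull (φ (lookup B zero ∷ roots m S)) (blockOkᵇ B) _
    where
    pull : ∀ x o a → toℕ (x ∧ (o ∧ a)) ≡ toℕ o * toℕ (x ∧ a)
    pull true  true  a = sym (+-identityʳ (toℕ a))
    pull true  false a = refl
    pull false true  a = refl
    pull false false a = refl

  sumSubsets-coronaTerm-suc : ∀ m (w : Subset m → ℕ) b k →
    sumSubsets m (λ R → w R * coronaTerm p q (b + ∣ R ∣) (suc ∣ ∁ R ∣) k)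
      ≡ atMostOneOf p (atMostOneOf q (λ s → sumSubsets m (λ R → w R * coronaTerm p q (s + b + ∣ R ∣) ∣ ∁ R ∣ k))) 0
  sumSubsets-coronaTerm-suc m w b k = begin
    sumSubsets m (λ R → w R * coronaTerm p q (b + ∣ R ∣) (suc ∣ ∁ R ∣) k)
      ≡⟨ sumSubsets-cong m (λ R → cong (w R *_) (coronaTerm-suc (b + ∣ R ∣) ∣ ∁ R ∣ k)) ⟩
    sumSubsets m (λ R → w R * atMostOneOf p (atMostOneOf q (T R)) 0)
      ≡⟨ sumSubsets-atMostOneOf m p w (λ R → atMostOneOf q (T R)) 0 ⟩
    atMostOneOf p (λ d → sumSubsets m (λ R → w R * atMostOneOf q (T R) d)) 0
      ≡⟨ cong₂ (λ x y → x + p * y) (sumSubsets-atMostOneOf m q w T 0) (sumSubsets-atMostOneOf m q w T 1) ⟩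
    atMostOneOf p (atMostOneOf q (λ s → sumSubsets m (λ R → w R * coronaTerm p q (s + b + ∣ R ∣) ∣ ∁ R ∣ k))) 0 ∎
    where
    open ≡-Reasoning
    T : Subset m → ℕ → ℕ
    T R s = coronaTerm p q (s + (b + ∣ R ∣)) ∣ ∁ R ∣ k

  -- The corona identity, restricted to the root sets R selected by φ; the extra factor x^b makes
  -- the induction over the blocks go through.
  count-by-roots : ∀ m (φ : Subset m → Bool) b k →
    sumSubsets (m * suc (p + q)) (λ S → toℕ (φ (roots m S) ∧ blocksOkᵇ m S) * δ (b + ∣ S ∣) k)
      ≡ sumSubsets m (λ R → toℕ (φ R) * coronaTerm p q (b + ∣ R ∣) ∣ ∁ R ∣ k)
  count-by-roots zero    φ b k = cong₂ _*_ (cong toℕ (∧-identityʳ (φ []))) (sym (shift-δ (b + 0) k))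
  count-by-roots (suc m) φ b k = begin
    sumSubsets (M + m * M) F
      ≡⟨ sumSubsets-++ M (m * M) F ⟩
    sumSubsets M (λ B → sumSubsets (m * M) (λ S → F (B ++ S)))
      ≡⟨ sumSubsets-cong M inner ⟩
    sumSubsets M (λ B → toℕ (blockOkᵇ B) * H (lookup B zero) (∣ B ∣ + b))
      ≡⟨ sumSubsets-blockOkᵇ (λ x s → H x (s + b)) ⟩
    H true (1 + b) + atMostOneOf p (atMostOneOf q (λ s → H false (s + b))) 0
      ≡⟨ cong₂ _+_ rootIn (sym (sumSubsets-coronaTerm-suc m (λ R → toℕ (φ (false ∷ R))) b k)) ⟩
    sumSubsets (suc m) (λ R → toℕ (φ R) * coronaTerm p q (b + ∣ R ∣) ∣ ∁ R ∣ k) ∎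
    where
    open ≡-Reasoning
    M : ℕ
    M = suc (p + q)
    F : Subset (M + m * M) → ℕ
    F S = toℕ (φ (roots (suc m) S) ∧ blocksOkᵇ (suc m) S) * δ (b + ∣ S ∣) k
    H : Bool → ℕ → ℕ
    H x c = sumSubsets m (λ R → toℕ (φ (x ∷ R)) * coronaTerm p q (c + ∣ R ∣) ∣ ∁ R ∣ k)
    inner : ∀ B → sumSubsets (m * M) (λ S → F (B ++ S)) ≡ toℕ (blockOkᵇ B) * H (lookup B zero) (∣ B ∣ + b)
    inner B = begin
      sumSubsets (m * M) (λ S → F (B ++ S))
        ≡⟨ sumSubsets-cong (m * M) reorder ⟩
      sumSubsets (m * M) (λ S → toℕ (blockOkᵇ B) * G S)
        ≡⟨ sumSubsets-*ˡ (m * M) (toℕ (blockOkᵇ B)) G ⟩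
      toℕ (blockOkᵇ B) * sumSubsets (m * M) G
        ≡⟨ cong (toℕ (blockOkᵇ B) *_) (count-by-roots m (λ R → φ (lookup B zero ∷ R)) (∣ B ∣ + b) k) ⟩
      toℕ (blockOkᵇ B) * H (lookup B zero) (∣ B ∣ + b) ∎
      where
      G : Subset (m * M) → ℕ
      G S = toℕ (φ (lookup B zero ∷ roots m S) ∧ blocksOkᵇ m S) * δ (∣ B ∣ + b + ∣ S ∣) k
      size : ∀ S → b + ∣ B ++ S ∣ ≡ ∣ B ∣ + b + ∣ S ∣
      size S = trans (cong (b +_) (∣++∣ B S)) (trans (sym (+-assoc b ∣ B ∣ ∣ S ∣)) (cong (_+ ∣ S ∣) (+-comm b ∣ B ∣)))
      reorder : ∀ S → F (B ++ S) ≡ toℕ (blockOkᵇ B) * G S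
      reorder S = trans (cong₂ _*_ (weight-++ m φ B S) (cong (λ s → δ s k) (size S))) (*-assoc (toℕ (blockOkᵇ B)) _ _)
    rootIn : H true (1 + b) ≡ sumSubsets m (λ R → toℕ (φ (true ∷ R)) * coronaTerm p q (b + suc ∣ R ∣) ∣ ∁ R ∣ k)
    rootIn = sumSubsets-cong m (λ R → cong (λ c → toℕ (φ (true ∷ R)) * coronaTerm p q c ∣ ∁ R ∣ k) (sym (+-suc b ∣ R ∣)))

  module _ {n} (G : Graph n) where

    corona-combine : ∀ i j a b →
      corona G p q (combine i a) (combine j b) ≡ kindAdj G i j (kind {p} {q} a) (kind {p} {q} b)
    corona-combine i j a b =
      cong₂ (λ x y → kindAdj G (proj₁ x) (proj₁ y) (kind {p} {q} (proj₂ x)) (kind {p} {q} (proj₂ y)))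
            (Finₚ.remQuot-combine i a) (Finₚ.remQuot-combine j b)

    blockGraph : Fin n → Graph (suc (p + q))
    blockGraph i a b = kindAdj G i i (kind {p} {q} a) (kind {p} {q} b)

    kindAdj-≢ : ∀ {i j} → i ≢ j → (x y : Kind p q) → (x ≡ root → y ≡ root → ⊥) → kindAdj G i j x y ≡ false
    kindAdj-≢ i≢j root    root    notBoth = ⊥-elim (notBoth refl refl)
    kindAdj-≢ i≢j root    (inP _) _ = ==-≢ i≢j
    kindAdj-≢ i≢j root    (inQ _) _ = ==-≢ i≢j
    kindAdj-≢ i≢j (inP _) root    _ = ==-≢ i≢j
    kindAdj-≢ i≢j (inQ _) root    _ = ==-≢ i≢j
    kindAdj-≢ i≢j (inP x) (inP y) _ = cong (_∧ not (x == y)) (==-≢ i≢j)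
    kindAdj-≢ i≢j (inQ x) (inQ y) _ = cong (_∧ not (x == y)) (==-≢ i≢j)
    kindAdj-≢ i≢j (inP _) (inQ _) _ = refl
    kindAdj-≢ i≢j (inQ _) (inP _) _ = refl

    blockGraph-root : ∀ i a → blockGraph i zero (suc a) ≡ true
    blockGraph-root i a with Fin.splitAt p a
    ... | inj₁ _ = ==-refl i
    ... | inj₂ _ = ==-refl i

    blockOkᵇ⁺ : ∀ i B → Independent (blockGraph i) B → blockOkᵇ B ≡ true
    blockOkᵇ⁺ i (true ∷ B) ind = emptyᵇ⁺ B λ a → ¬-not λ Ba →
      contradiction (trans (sym (blockGraph-root i a)) (ind zero (suc a) refl Ba Finₚ.0≢1+n)) λ ()
    blockOkᵇ⁺ i (false ∷ B) ind = cong₂ _∧_ (atMostOneᵇ⁺ (take p B) sameP) (atMostOneᵇ⁺ (drop p B) sameQ)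
      where
      sameP : ∀ x y → lookup (take p B) x ≡ true → lookup (take p B) y ≡ true → x ≡ y
      sameP x y Bx By = decidable-stable (x ≟ y) λ x≢y → contradiction
        (ind (suc (x ↑ˡ q)) (suc (y ↑ˡ q)) (trans (lookup-↑ˡ p B x) Bx) (trans (lookup-↑ˡ p B y) By)
             (x≢y ∘ Finₚ.↑ˡ-injective q x y ∘ Finₚ.suc-injective))
        (adjacent x≢y)
        where
        adjacent : x ≢ y → blockGraph i (suc (x ↑ˡ q)) (suc (y ↑ˡ q)) ≢ false
        adjacent x≢y rewrite kind-↑ˡ x | kind-↑ˡ y | ==-refl i | ==-≢ x≢y = λ ()
      sameQ : ∀ x y → lookup (drop p B) x ≡ true → lookup (drop p B) y ≡ true → x ≡ y
      sameQ x y Bx By = decidable-stable (x ≟ y) λ x≢y → contradiction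
        (ind (suc (p ↑ʳ x)) (suc (p ↑ʳ y)) (trans (lookup-↑ʳ p B x) Bx) (trans (lookup-↑ʳ p B y) By)
             (x≢y ∘ Finₚ.↑ʳ-injective p x y ∘ Finₚ.suc-injective))
        (adjacent x≢y)
        where
        adjacent : x ≢ y → blockGraph i (suc (p ↑ʳ x)) (suc (p ↑ʳ y)) ≢ false
        adjacent x≢y rewrite kind-↑ʳ x | kind-↑ʳ y | ==-refl i | ==-≢ x≢y = λ ()

    blockOkᵇ⁻ : ∀ i B → blockOkᵇ B ≡ true → Independent (blockGraph i) B
    blockOkᵇ⁻ i (true ∷ B) ok zero    zero    _  _  a≢b = contradiction refl a≢b
    blockOkᵇ⁻ i (true ∷ B) ok zero    (suc b) _  Bb _   = contradiction (trans (sym Bb) (emptyᵇ⁻ B ok b)) λ ()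
    blockOkᵇ⁻ i (true ∷ B) ok (suc a) _       Ba _  _   = contradiction (trans (sym Ba) (emptyᵇ⁻ B ok a)) λ ()
    blockOkᵇ⁻ i (false ∷ B) ok (suc a) (suc b) Ba Bb a≢b
      with Fin.splitAt p a in ea | Fin.splitAt p b in eb
    ... | inj₁ x | inj₂ y = refl
    ... | inj₂ x | inj₁ y = refl
    ... | inj₁ x | inj₁ y
      rewrite atMostOneᵇ⁻ (take p B) (∧-conicalˡ _ _ ok) x y
                (trans (sym (lookup-↑ˡ p B x)) (trans (cong (lookup B) (Finₚ.splitAt⁻¹-↑ˡ ea)) Ba))
                (trans (sym (lookup-↑ˡ p B y)) (trans (cong (lookup B) (Finₚ.splitAt⁻¹-↑ˡ eb)) Bb))
            | ==-refl y | ==-refl i = refl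
    ... | inj₂ x | inj₂ y
      rewrite atMostOneᵇ⁻ (drop p B) (∧-conicalʳ _ _ ok) x y
                (trans (sym (lookup-↑ʳ p B x)) (trans (cong (lookup B) (Finₚ.splitAt⁻¹-↑ʳ ea)) Ba))
                (trans (sym (lookup-↑ʳ p B y)) (trans (cong (lookup B) (Finₚ.splitAt⁻¹-↑ʳ eb)) Bb))
            | ==-refl y | ==-refl i = refl

    IndependentBlocks : Subset (n * suc (p + q)) → Set
    IndependentBlocks S = ∀ i a j b → lookup (block n S i) a ≡ true → lookup (block n S j) b ≡ true →
      (i , a) ≢ (j , b) → kindAdj G i j (kind {p} {q} a) (kind {p} {q} b) ≡ false

    corona⇒blocks : ∀ S → Independent (corona G p q) S → IndependentBlocks S
    corona⇒blocks S ind i a j b Sia Sjb ia≢jb = trans (sym (corona-combine i j a b))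
      (ind (combine i a) (combine j b) (trans (lookup-combine n S i a) Sia) (trans (lookup-combine n S j b) Sjb)
           λ e → ia≢jb (trans (sym (Finₚ.remQuot-combine i a))
                              (trans (cong (Fin.remQuot (suc (p + q))) e) (Finₚ.remQuot-combine j b))))

    blocks⇒corona : ∀ S → IndependentBlocks S → Independent (corona G p q) S
    blocks⇒corona S ind u v Su Sv u≢v =
      ind _ _ _ _ (inBlock u Su) (inBlock v Sv) (λ e → u≢v (trans (sym (decode u)) (trans (cong (uncurry combine) e) (decode v))))
      where
      decode : ∀ w → uncurry combine (Fin.remQuot {n} (suc (p + q)) w) ≡ w
      decode = Finₚ.combine-remQuot {n} (suc (p + q))
      inBlock : ∀ w → lookup S w ≡ true →
        lookup (block n S (proj₁ (Fin.remQuot {n} (suc (p + q)) w))) (proj₂ (Fin.remQuot {n} (suc (p + q)) w)) ≡ true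
      inBlock w Sw = trans (sym (lookup-combine n S _ _)) (trans (cong (lookup S) (decode w)) Sw)

    lookup-roots : ∀ S i → lookup (roots n S) i ≡ lookup (block n S i) zero
    lookup-roots S = lookup∘tabulate (λ i → lookup (block n S i) zero)

    blocks⇒roots : ∀ S → IndependentBlocks S → Independent G (roots n S)
    blocks⇒roots S ind i j Si Sj i≢j =
      ind i zero j zero (trans (sym (lookup-roots S i)) Si) (trans (sym (lookup-roots S j)) Sj) (i≢j ∘ cong proj₁)

    blocks⇒local : ∀ S → IndependentBlocks S → ∀ i → Independent (blockGraph i) (block n S i)
    blocks⇒local S ind i a b Sa Sb a≢b = ind i a i b Sa Sb (a≢b ∘ cong proj₂)

    roots⇒across : ∀ S → Independent G (roots n S) → ∀ {i j} → i ≢ j → ∀ a b →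
      lookup (block n S i) a ≡ true → lookup (block n S j) b ≡ true →
      kindAdj G i j (kind {p} {q} a) (kind {p} {q} b) ≡ false
    roots⇒across S ind {i} {j} i≢j zero zero Sia Sjb =
      ind i j (trans (lookup-roots S i) Sia) (trans (lookup-roots S j) Sjb) i≢j
    roots⇒across S ind i≢j zero (suc b) _ _ = kindAdj-≢ i≢j root _ λ _ → kind-suc≢root b
    roots⇒across S ind i≢j (suc a) b _ _ = kindAdj-≢ i≢j _ _ λ e → ⊥-elim (kind-suc≢root a e)

    roots+local⇒blocks : ∀ S → Independent G (roots n S) → (∀ i → Independent (blockGraph i) (block n S i)) →
      IndependentBlocks S
    roots+local⇒blocks S indR indL i a j b Sia Sjb ia≢jb with i ≟ j
    ... | yes refl = indL i a b Sia Sjb (ia≢jb ∘ cong (i ,_))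
    ... | no  i≢j  = roots⇒across S indR i≢j a b Sia Sjb

    independentᵇ-corona : ∀ S → independentᵇ (corona G p q) S ≡ independentᵇ G (roots n S) ∧ blocksOkᵇ n S
    independentᵇ-corona S = ⇔→≡ {z = true} (mk⇔ to from)
      where
      to : independentᵇ (corona G p q) S ≡ true → independentᵇ G (roots n S) ∧ blocksOkᵇ n S ≡ true
      to h = cong₂ _∧_ (independentᵇ⁺ G (roots n S) (blocks⇒roots S ind))
                       (allL-allFinL⁺ _ λ i → blockOkᵇ⁺ i (block n S i) (blocks⇒local S ind i))
        where
        ind : IndependentBlocks S
        ind = corona⇒blocks S (independentᵇ⁻ (corona G p q) S h)
      from : independentᵇ G (roots n S) ∧ blocksOkᵇ n S ≡ true → independentᵇ (corona G p q) S ≡ true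
      from h = independentᵇ⁺ (corona G p q) S (blocks⇒corona S (roots+local⇒blocks S
                 (independentᵇ⁻ G (roots n S) (∧-conicalˡ _ _ h))
                 λ i → blockOkᵇ⁻ i (block n S i) (allL-allFinL⁻ _ (∧-conicalʳ _ _ h) i)))

indepCount-corona : ∀ {n} (G : Graph n) p q k →
  indepCount (corona G p q) k ≡ sumSubsets n (λ R → toℕ (independentᵇ G R) * coronaTerm p q ∣ R ∣ ∣ ∁ R ∣ k)
indepCount-corona {n} G p q k = begin
  indepCount (corona G p q) k
    ≡⟨ sum-map-subsets (n * suc (p + q)) _ ⟩
  sumSubsets (n * suc (p + q)) (λ S → toℕ (independentᵇ (corona G p q) S ∧ ⌊ ∣ S ∣ ℕ.≟ k ⌋))
    ≡⟨ sumSubsets-cong (n * suc (p + q)) factor ⟩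
  sumSubsets (n * suc (p + q)) (λ S → toℕ (independentᵇ G (roots p q n S) ∧ blocksOkᵇ p q n S) * δ ∣ S ∣ k)
    ≡⟨ count-by-roots p q n (independentᵇ G) 0 k ⟩
  sumSubsets n (λ R → toℕ (independentᵇ G R) * coronaTerm p q ∣ R ∣ ∣ ∁ R ∣ k) ∎
  where
  open ≡-Reasoning
  factor : ∀ S → toℕ (independentᵇ (corona G p q) S ∧ ⌊ ∣ S ∣ ℕ.≟ k ⌋)
                 ≡ toℕ (independentᵇ G (roots p q n S) ∧ blocksOkᵇ p q n S) * δ ∣ S ∣ k
  factor S rewrite independentᵇ-corona p q G S =
    trans (toℕ-∧ _ ⌊ ∣ S ∣ ℕ.≟ k ⌋) (cong (toℕ (independentᵇ G (roots p q n S) ∧ blocksOkᵇ p q n S) *_) (toℕ-≟ ∣ S ∣ k))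

≤-ceilDiv : ∀ a b → a ≤ ceilDiv a (suc b) * suc b
≤-ceilDiv a b = +-cancelʳ-≤ b a (ceilDiv a (suc b) * suc b) (begin
  a + b                                  ≡⟨ m≡m%n+[m/n]*n (a + b) (suc b) ⟩
  (a + b) % suc b + ceilDiv a (suc b) * suc b ≤⟨ +-monoˡ-≤ _ (s≤s⁻¹ (m%n<n (a + b) (suc b))) ⟩
  b + ceilDiv a (suc b) * suc b          ≡⟨ +-comm b _ ⟩
  ceilDiv a (suc b) * suc b + b          ∎)
  where open ≤-Reasoning

∣R∣+∣∁R∣≡n : ∀ {n} (R : Subset n) → ∣ R ∣ + ∣ ∁ R ∣ ≡ n
∣R∣+∣∁R∣≡n R = trans (cong (∣ R ∣ +_) (∣∁p∣≡n∸∣p∣ R)) (m+[n∸m]≡n (∣p∣≤n R))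

indepCount-corona-antitone : ∀ {n} (G : Graph n) {p q w} k → 1 ≤ w → p ≤ w → q ≤ w →
  2 * n * w ≤ k * suc w + 1 → indepCount (corona G p q) (suc k) ≤ indepCount (corona G p q) k
indepCount-corona-antitone {n} G {p} {q} {w} k 1≤w p≤w q≤w h
  rewrite indepCount-corona G p q (suc k) | indepCount-corona G p q k =
  sumSubsets-mono n λ R → *-monoʳ-≤ (toℕ (independentᵇ G R)) (coronaTerm-antitone ∣ R ∣ ∣ ∁ R ∣ k 1≤w p≤w q≤w
    (subst (λ m → 2 * m * w ≤ k * suc w + 1) (sym (∣R∣+∣∁R∣≡n R)) h))

indepCount-corona-monotone : ∀ {n} (G : Graph n) {p q} k → 1 ≤ p → 1 ≤ q → k < n →
  indepCount (corona G p q) k ≤ indepCount (corona G p q) (suc k)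
indepCount-corona-monotone {n} G {p} {q} k 1≤p 1≤q k<n
  rewrite indepCount-corona G p q k | indepCount-corona G p q (suc k) =
  sumSubsets-mono n λ R → *-monoʳ-≤ (toℕ (independentᵇ G R))
    (coronaTerm-monotone ∣ R ∣ ∣ ∁ R ∣ k 1≤p 1≤q (subst (k <_) (sym (∣R∣+∣∁R∣≡n R)) k<n))

≤-ceilDiv-pred : ∀ a w → a ≤ ceilDiv (a ∸ 1) (w + 1) * suc w + 1
≤-ceilDiv-pred a w = begin
  a                                    ≤⟨ m≤n+m∸n a 1 ⟩
  1 + (a ∸ 1)                          ≤⟨ +-monoʳ-≤ 1 (subst (λ d → a ∸ 1 ≤ ceilDiv (a ∸ 1) d * suc w)
                                            (+-comm 1 w) (≤-ceilDiv (a ∸ 1) w)) ⟩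
  1 + ceilDiv (a ∸ 1) (w + 1) * suc w  ≡⟨ +-comm 1 _ ⟩
  ceilDiv (a ∸ 1) (w + 1) * suc w + 1  ∎
  where open ≤-Reasoning

proposition2p6 : (n : ℕ) (G : Graph n) → IsSimple G → Perfect G → 1 ≤ n →
    (p q : ℕ) → 1 ≤ p → 1 ≤ q →
    (ωG : ℕ) → HasCliqueNumber G ωG →
    let ω = ωG ⊔ p ⊔ q
        s = indepCount (corona G p q)
        c = ceilDiv (2 * n * ω ∸ 1) (ω + 1)
        t = 2 * n ∸ c
    in ((k : ℕ) → c ≤ k → k < 2 * n → s (suc k) ≤ s k)
       × ((k : ℕ) → k < t → s k ≤ s (suc k))
proposition2p6 n G _ _ _ p q 1≤p 1≤q ωG _ = decreasing , increasing
  where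
  ω c : ℕ
  ω = ωG ⊔ p ⊔ q
  c = ceilDiv (2 * n * ω ∸ 1) (ω + 1)
  p≤ω : p ≤ ω
  p≤ω = ≤-trans (m≤n⊔m ωG p) (m≤m⊔n (ωG ⊔ p) q)
  q≤ω : q ≤ ω
  q≤ω = m≤n⊔m (ωG ⊔ p) q
  1≤ω : 1 ≤ ω
  1≤ω = ≤-trans 1≤p p≤ω
  decreasing : ∀ k → c ≤ k → k < 2 * n → indepCount (corona G p q) (suc k) ≤ indepCount (corona G p q) k
  decreasing k c≤k _ = indepCount-corona-antitone G k 1≤ω p≤ω q≤ω
    (≤-trans (≤-ceilDiv-pred (2 * n * ω) ω) (+-monoˡ-≤ 1 (*-monoˡ-≤ (suc ω) c≤k)))
  n≤c : n ≤ c
  n≤c = 2Nw≤k[1+w]+1⇒N≤k 1≤ω (≤-ceilDiv-pred (2 * n * ω) ω)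
  increasing : ∀ k → k < 2 * n ∸ c → indepCount (corona G p q) k ≤ indepCount (corona G p q) (suc k)
  increasing k k<2n∸c = indepCount-corona-monotone G k 1≤p 1≤q
    (≤-trans k<2n∸c (≤-trans (∸-monoʳ-≤ (2 * n) n≤c) (≤-reflexive 2n∸n≡n)))
    where
    2n∸n≡n : 2 * n ∸ n ≡ n
    2n∸n≡n = trans (m+n∸m≡n n (n + 0)) (+-identityʳ n)
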